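{- Let $R$ be a Łukasiewicz ring, and fix an isomorphism of MV-algebras $\mathrm{Id}(R)\cong\prod_{x\in X}\text{Ł}_{n_x}$ for some nonempty set $X$ and integers $n_x\ge2$. For $I\in\mathrm{Id}(R)$ let $\sqrt{I}=\bigcap\{P: P \text{ a prime ideal of } R,\ I\subseteq P\}$. Then the map $I\mapsto\sqrt{I}$ on $\mathrm{Id}(R)$ is (i) a closure operator, (ii) a nucleus, (iii) inductive, and (iv) not dense, unless $n_x=2$ for all $x\in X$.
   Context: For a commutative ring $R$ with identity, $\mathrm{Id}(R)$ is the lattice of ideals ordered by inclusion, with $\bigwedge I_k=\bigcap I_k$ and $\bigvee I_k$ the ideal generated by $\bigcup I_k$. $R$ is a Łukasiewicz ring if $\mathrm{Id}(R)$ with $\neg I=\mathrm{Ann}(I)$ (the annihilator), $I\oplus J=\mathrm{Ann}(\mathrm{Ann}(I)\mathrm{Ann}(J))$, $0=\{0\}$, $1=R$ is an MV-algebra (whose lattice order is inclusion); such an $\mathrm{Id}(R)$ is isomorphic to a product of finite Łukasiewicz chains $\text{Ł}_n=\{0,\frac1{n-1},\dots,1\}$. For a complete MV-algebra $A$: a closure operator is a map $j:A\to A$ that is extensive ($x\le j(x)$), monotone and idempotent; a nucleus is a closure operator with $j(a\wedge b)=j(a)\wedge j(b)$; $j$ is dense if $j(0)=0$; $j$ is inductive if $j(x)=\bigvee\{j(a):a\in\mathfrak{k}(A),\ a\le x\}$ for all $x$, where $\mathfrak{k}(A)$ is the set of compact elements ($a$ compact if $a\le\bigvee S$ implies $a\le\bigvee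 F$ for some finite $F\subseteq S$). -}

module Defs where

open import Level using (Level; _⊔_; suc)
open import Algebra.Bundles using (CommutativeRing)
open import Data.Nat using (ℕ; _≤_; s≤s; _⊓_; _∸_) renaming (_+_ to _+ℕ_; suc to sucℕ)
open import Data.Nat.Properties using (m⊓n≤m)
open import Data.Fin using (Fin; toℕ; fromℕ<; opposite)
open import Data.List using (List; length; lookup)
open import Data.Product using (Σ; ∃; _×_; _,_; proj₁)
open import Data.Sum using (_⊎_)
open import Data.Unit.Polymorphic using (⊤)
open import Relation.Binary.PropositionalEquality using (_≡_)
open import Relation.Nullary using (¬_)

-- Finite Łukasiewicz chains Ł_n = {0, 1/(n-1), ..., 1}, represented by
-- Fin n (i ↦ i/(n-1)).  ¬x = 1 - x,  x ⊕ y = min(1, x + y).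

¬Ł : ∀ {n} → Fin n → Fin n
¬Ł = opposite

_⊕Ł_ : ∀ {n} → Fin n → Fin n → Fin n
_⊕Ł_ {sucℕ m} i j = fromℕ< {m ⊓ (toℕ i +ℕ toℕ j)} (s≤s (m⊓n≤m m (toℕ i +ℕ toℕ j)))

ΠŁ : ∀ {a} (X : Set a) (n : X → ℕ) → Set a
ΠŁ X n = (x : X) → Fin (n x)

_≈Π_ : ∀ {a} {X : Set a} {n : X → ℕ} → ΠŁ X n → ΠŁ X n → Set a
u ≈Π v = ∀ x → u x ≡ v x

module Ring {c ℓ} (R : CommutativeRing c ℓ) where
  open CommutativeRing R

  Pr : (q : Level) → Set (c ⊔ suc q)
  Pr q = Carrier → Set q

  _⊆_ : ∀ {a b} → Pr a → Pr b → Set (c ⊔ a ⊔ b)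
  A ⊆ B = ∀ {x} → A x → B x

  _≐_ : ∀ {a b} → Pr a → Pr b → Set (c ⊔ a ⊔ b)
  A ≐ B = (A ⊆ B) × (B ⊆ A)

  _∩_ : ∀ {a b} → Pr a → Pr b → Pr (a ⊔ b)
  (A ∩ B) x = A x × B x

  record IsIdeal {q} (I : Pr q) : Set (c ⊔ ℓ ⊔ q) where
    field
      resp    : ∀ {x y} → x ≈ y → I x → I y
      has0    : I 0#
      +closed : ∀ {x y} → I x → I y → I (x + y)
      *closed : ∀ r {x} → I x → I (r * x)

  record Ideal (q : Level) : Set (c ⊔ ℓ ⊔ suc q) where
    field
      pred    : Pr q
      isIdeal : IsIdeal pred
  open Ideal public

  p : Level
  p = c ⊔ ℓ

  Id : Set _
  Id = Ideal p

  data Gen {k q} {K : Set k} (f : K → Pr q) : Carrier → Set (c ⊔ ℓ ⊔ k ⊔ q) where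
    gen-0    : Gen f 0#
    gen-in   : ∀ i {x} → f i x → Gen f x
    gen-+    : ∀ {x y} → Gen f x → Gen f y → Gen f (x + y)
    gen-*    : ∀ r {x} → Gen f x → Gen f (r * x)
    gen-resp : ∀ {x y} → x ≈ y → Gen f x → Gen f y

  Zero : Pr ℓ
  Zero x = x ≈ 0#

  Whole : Pr p
  Whole _ = ⊤

  Ann : ∀ {q} → Pr q → Pr (c ⊔ ℓ ⊔ q)
  Ann I x = ∀ {y} → I y → x * y ≈ 0#

  Prod : ∀ {a b} → Pr a → Pr b → Pr (c ⊔ ℓ ⊔ a ⊔ b)
  Prod {a} {b} I J = Gen {K = Σ (Carrier × Carrier) (λ { (u , v) → I u × J v })}
                         (λ { ((u , v) , _) z → z ≈ u * v })

  NegI : ∀ {q} → Pr q → Pr (c ⊔ ℓ ⊔ q)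
  NegI = Ann

  OplusI : ∀ {a b} → Pr a → Pr b → Pr (c ⊔ ℓ ⊔ a ⊔ b)
  OplusI I J = Ann (Prod (Ann I) (Ann J))

  record IsMVIso {a} (X : Set a) (n : X → ℕ) (φ : Id → ΠŁ X n) : Set (suc p ⊔ a) where
    field
      well-def   : ∀ I J → pred I ≐ pred J → φ I ≈Π φ J
      injective  : ∀ I J → φ I ≈Π φ J → pred I ≐ pred J
      surjective : ∀ (u : ΠŁ X n) → Σ Id (λ I → φ I ≈Π u)
      pres-0     : ∀ K → pred K ≐ Zero → ∀ x → toℕ (φ K x) ≡ 0
      pres-1     : ∀ K → pred K ≐ Whole → ∀ x → toℕ (φ K x) ≡ n x ∸ 1
      pres-¬     : ∀ I K → pred K ≐ NegI (pred I) → φ K ≈Π (λ x → ¬Ł (φ I x))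
      pres-⊕     : ∀ I J K → pred K ≐ OplusI (pred I) (pred J) →
                   φ K ≈Π (λ x → φ I x ⊕Ł φ J x)

  record IsPrime (P : Id) : Set p where
    field
      proper : ¬ (pred P 1#)
      prime  : ∀ a b → pred P (a * b) → pred P a ⊎ pred P b

  rad : ∀ {q} → Pr q → Pr (suc p ⊔ q)
  rad I x = ∀ (P : Id) → IsPrime P → I ⊆ pred P → pred P x

  IsCompact : Id → Set (suc (suc p))
  IsCompact a = ∀ (K : Set (suc p)) (f : K → Id) →
    pred a ⊆ Gen (λ i → pred (f i)) →
    Σ (List K) (λ ks → pred a ⊆ Gen (λ (i : Fin (length ks)) → pred (f (lookup ks i))))

  Extensive : Set _
  Extensive = ∀ (I : Id) → pred I ⊆ rad (pred I)

  Monotone : Set _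
  Monotone = ∀ (I J : Id) → pred I ⊆ pred J → rad (pred I) ⊆ rad (pred J)

  Idempotent : Set _
  Idempotent = ∀ (I : Id) → rad (rad (pred I)) ≐ rad (pred I)

  IsClosureOperator : Set _
  IsClosureOperator = Extensive × Monotone × Idempotent

  PreservesMeets : Set _
  PreservesMeets = ∀ (I J : Id) → rad (pred I ∩ pred J) ≐ (rad (pred I) ∩ rad (pred J))

  IsNucleus : Set _
  IsNucleus = IsClosureOperator × PreservesMeets

  IsInductive : Set _
  IsInductive = ∀ (I : Id) →
    rad (pred I) ≐ Gen {K = Σ Id (λ a → IsCompact a × (pred a ⊆ pred I))}
                       (λ ac → rad (pred (proj₁ ac)))

  IsDense : Set _
  IsDense = rad Zero ≐ Zero

{-# OPTIONS --safe #-}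
-- Through φ, inclusion of ideals is the pointwise order of ∏ Ł_{n_x} (I ⊆ J iff ¬I ⊕ J = R), so ∩
-- and + become pointwise min and max, and an ideal with {0,1}-valued image is generated by an
-- idempotent, hence compact.  If P is prime and A is the ideal one step above P wherever that is
-- possible, then A·A ⊆ A ⊙ A ⊆ P forces A ⊆ P; so φ P ≥ n − 2 everywhere.  Hence √I only sees
-- the coordinates where φ I = 1: √I = √T for the idempotent-generated T ⊆ I supported there
-- (inductivity), and √0 contains the ideal with image n − 2 (so density forces n = 2).
-- Conversely, when every n_x = 2 each {z : φ(zR)_x = 0} is prime, whence √0 = 0.  Primes are
-- meet-prime (so √ preserves ∩) because the parts of I and J exceeding P are generated by
-- idempotents with product 0.
module Submission where

open import Defs
open import Level using (Level; Lift; lift; lower)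
open import Algebra.Bundles using (CommutativeRing)
import Algebra.Construct.NaturalChoice.Max as Max
import Algebra.Construct.NaturalChoice.Min as Min
open import Data.Nat using (ℕ; suc; _≤_; _<_; _∸_; s≤s; z≤n; _<?_; _≟_)
open import Data.Nat.Properties
  using (≤-trans; ≤-reflexive; ≤-antisym; <⇒≤; <⇒≱; ≮⇒≥; ∸-monoˡ-≤; n≤0⇒n≡0; m∸n≡0⇒m≤n)
open import Data.Fin as Fin using (Fin; toℕ)
open import Data.Fin.Properties using (≤-totalOrder; toℕ-injective; opposite-involutive)
  renaming (≤-antisym to ≤ᶠ-antisym)
open import Data.List using (List; []; _∷_; _++_; length; lookup)
open import Data.List.Membership.Propositional.Properties using (∈-lookup)
open import Data.List.Relation.Binary.Subset.Propositional using () renaming (_⊆_ to _⊆ˡ_)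
open import Data.List.Relation.Binary.Subset.Propositional.Properties using (xs⊆xs++ys; xs⊆ys++xs)
open import Data.List.Relation.Unary.Any using (index)
open import Data.List.Relation.Unary.Any.Properties using (lookup-index)
open import Data.Product using (∃; ∃₂; _×_; _,_; proj₁; proj₂; map₂)
open import Data.Sum using (_⊎_; inj₁; inj₂; [_,_])
import Data.Sum as Sum
open import Data.Unit.Polymorphic using (tt)
open import Function.Base using (id)
open import Function.Bundles using (_⇔_; mk⇔)
open import Relation.Nullary using (¬_; Dec; yes; no; contradiction)
import Relation.Binary.PropositionalEquality as ≡
open ≡ using (_≡_; _≢_; cong; cong₂; subst)

module LukasiewiczChain where
  open import Data.Nat using (_+_; _⊓_; _⊔_; _≤?_; s≤s⁻¹)
  open import Data.Nat.Properties
  open import Data.Fin using (fromℕ; fromℕ<; inject₁) renaming (zero to fzero)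
  open import Data.Fin.Properties
    using (toℕ≤pred[n]; opposite-prop; toℕ-fromℕ; toℕ-fromℕ<; toℕ-inject₁)
  open ≡ using (sym; trans)
  open ≤-Reasoning

  toℕ≤top : ∀ {k} (i : Fin k) → toℕ i ≤ k ∸ 1
  toℕ≤top {suc _} = toℕ≤pred[n]

  ≢top⇒≤top∸1 : ∀ {k} (i : Fin k) → toℕ i ≢ k ∸ 1 → toℕ i ≤ k ∸ 2
  ≢top⇒≤top∸1 {suc _} i ≢top = <⇒≤pred (≤∧≢⇒< (toℕ≤top i) ≢top)

  toℕ-¬Ł : ∀ {k} (i : Fin k) → toℕ (¬Ł i) ≡ k ∸ 1 ∸ toℕ i
  toℕ-¬Ł {suc _} = opposite-prop

  toℕ-⊕Ł : ∀ {k} (i j : Fin k) → toℕ (i ⊕Ł j) ≡ (k ∸ 1) ⊓ (toℕ i + toℕ j)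
  toℕ-⊕Ł {suc _} i j = toℕ-fromℕ< _

  toℕ-¬Ł⊕Ł : ∀ {k} (i j : Fin k) → toℕ (¬Ł i ⊕Ł j) ≡ (k ∸ 1) ⊓ (k ∸ 1 ∸ toℕ i + toℕ j)
  toℕ-¬Ł⊕Ł i j = trans (toℕ-⊕Ł (¬Ł i) j) (cong (λ t → _ ⊓ (t + toℕ j)) (toℕ-¬Ł i))

  ≤⇒¬Ł⊕Ł≡top : ∀ {k} {i j : Fin k} → toℕ i ≤ toℕ j → toℕ (¬Ł i ⊕Ł j) ≡ k ∸ 1
  ≤⇒¬Ł⊕Ł≡top {k} {i} {j} i≤j = trans (toℕ-¬Ł⊕Ł i j) (m≤n⇒m⊓n≡m (begin
    k ∸ 1                   ≡⟨ sym (m∸n+n≡m (toℕ≤top i)) ⟩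
    k ∸ 1 ∸ toℕ i + toℕ i   ≤⟨ +-monoʳ-≤ (k ∸ 1 ∸ toℕ i) i≤j ⟩
    k ∸ 1 ∸ toℕ i + toℕ j   ∎))

  ¬Ł⊕Ł≡top⇒≤ : ∀ {k} (i j : Fin k) → toℕ (¬Ł i ⊕Ł j) ≡ k ∸ 1 → toℕ i ≤ toℕ j
  ¬Ł⊕Ł≡top⇒≤ {k} i j ≡top = +-cancelˡ-≤ (k ∸ 1 ∸ toℕ i) (toℕ i) (toℕ j) (begin
    k ∸ 1 ∸ toℕ i + toℕ i   ≡⟨ m∸n+n≡m (toℕ≤top i) ⟩
    k ∸ 1                   ≤⟨ m⊓n≡m⇒m≤n (trans (sym (toℕ-¬Ł⊕Ł i j)) ≡top) ⟩
    k ∸ 1 ∸ toℕ i + toℕ j   ∎)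

  _⊙Ł_ : ∀ {k} → Fin k → Fin k → Fin k
  i ⊙Ł j = ¬Ł (¬Ł i ⊕Ł ¬Ł j)

  toℕ-⊙Ł : ∀ {k} (i j : Fin k) → toℕ (i ⊙Ł j) ≡ toℕ i ∸ (k ∸ 1 ∸ toℕ j)
  toℕ-⊙Ł {k} i j = begin-equality
    toℕ (¬Ł (¬Ł i ⊕Ł ¬Ł j))           ≡⟨ toℕ-¬Ł (¬Ł i ⊕Ł ¬Ł j) ⟩
    m ∸ toℕ (¬Ł i ⊕Ł ¬Ł j)           ≡⟨ cong (m ∸_) (toℕ-⊕Ł (¬Ł i) (¬Ł j)) ⟩
    m ∸ (m ⊓ (toℕ (¬Ł i) + toℕ (¬Ł j))) ≡⟨ cong₂ (λ s t → m ∸ (m ⊓ (s + t))) (toℕ-¬Ł i) (toℕ-¬Ł j) ⟩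
    m ∸ (m ⊓ (m ∸ a + (m ∸ b)))      ≡⟨ ∸-distribˡ-⊓-⊔ m m _ ⟩
    (m ∸ m) ⊔ (m ∸ (m ∸ a + (m ∸ b))) ≡⟨ cong (_⊔ (m ∸ (m ∸ a + (m ∸ b)))) (n∸n≡0 m) ⟩
    m ∸ (m ∸ a + (m ∸ b))            ≡⟨ sym (∸-+-assoc m (m ∸ a) (m ∸ b)) ⟩
    m ∸ (m ∸ a) ∸ (m ∸ b)            ≡⟨ cong (_∸ (m ∸ b)) (m∸[m∸n]≡n (toℕ≤top i)) ⟩
    a ∸ (m ∸ b)                      ∎
    where
    m a b : ℕ
    m = k ∸ 1
    a = toℕ i
    b = toℕ j

  -- b is i raised by one step, unless i is already one of the top two elements.
  ∃-bump : ∀ {k} (i : Fin k) →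
           ∃ λ (b : Fin k) → toℕ (b ⊙Ł b) ≤ toℕ i × (toℕ b ≤ toℕ i → k ∸ 2 ≤ toℕ i)
  ∃-bump {suc m} i with 2 + toℕ i ≤? m
  ... | yes 2+i≤m = b , square≤i , λ b≤i → contradiction (subst (_≤ toℕ i) toℕ-b b≤i) 1+n≰n
    where
    b : Fin (suc m)
    b = fromℕ< (m≤n⇒m≤1+n 2+i≤m)
    toℕ-b : toℕ b ≡ suc (toℕ i)
    toℕ-b = toℕ-fromℕ< (m≤n⇒m≤1+n 2+i≤m)
    1+i≤m∸[1+i]+i : suc (toℕ i) ≤ m ∸ suc (toℕ i) + toℕ i
    1+i≤m∸[1+i]+i = +-monoˡ-≤ (toℕ i) (m<n⇒0<n∸m 2+i≤m)
    square≤i : toℕ (b ⊙Ł b) ≤ toℕ i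
    square≤i = begin
      toℕ (b ⊙Ł b)                        ≡⟨ toℕ-⊙Ł b b ⟩
      toℕ b ∸ (m ∸ toℕ b)                 ≡⟨ cong (λ t → t ∸ (m ∸ t)) toℕ-b ⟩
      suc (toℕ i) ∸ (m ∸ suc (toℕ i))     ≤⟨ m≤n+o⇒m∸n≤o _ _ 1+i≤m∸[1+i]+i ⟩
      toℕ i                               ∎
  ... | no 2+i≰m = i , ≤-trans (≤-reflexive (toℕ-⊙Ł i i)) (m∸n≤m (toℕ i) (m ∸ toℕ i))
                 , λ _ → ∸-monoˡ-≤ 1 (s≤s⁻¹ (≰⇒> 2+i≰m))

  indicator : ∀ {k q} {A : Set q} → 1 ≤ k → Dec A → Fin k
  indicator {suc m} _ (yes _) = fromℕ m
  indicator {suc m} _ (no _)  = fzero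

  toℕ-indicator-yes : ∀ {k q} {A : Set q} (1≤k : 1 ≤ k) (A? : Dec A) → A →
                      toℕ (indicator 1≤k A?) ≡ k ∸ 1
  toℕ-indicator-yes {suc m} _ (yes _) _  = toℕ-fromℕ m
  toℕ-indicator-yes {suc m} _ (no ¬a) a = contradiction a ¬a

  toℕ-indicator-no : ∀ {k q} {A : Set q} (1≤k : 1 ≤ k) (A? : Dec A) → ¬ A →
                     toℕ (indicator 1≤k A?) ≡ 0
  toℕ-indicator-no {suc m} _ (yes a) ¬a = contradiction a ¬a
  toℕ-indicator-no {suc m} _ (no _)  _  = ≡.refl

  penultimate : ∀ {k} → 2 ≤ k → Fin k
  penultimate (s≤s (s≤s {n = m} _)) = inject₁ (fromℕ m)

  toℕ-penultimate : ∀ {k} (2≤k : 2 ≤ k) → toℕ (penultimate 2≤k) ≡ k ∸ 2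
  toℕ-penultimate (s≤s (s≤s {n = m} _)) = trans (toℕ-inject₁ (fromℕ m)) (toℕ-fromℕ m)

open LukasiewiczChain

module FinMin {k} = Min (≤-totalOrder k)
module FinMax {k} = Max (≤-totalOrder k)
open FinMin using (x⊓y≤x; x⊓y≤y; ⊓-glb; ⊓-sel) renaming (_⊓_ to _∧_)
open FinMax using (x≤x⊔y; x≤y⊔x; ⊔-lub) renaming (_⊔_ to _∨_)

∧≤⇒≤⊎≤ : ∀ {k} (i j l : Fin k) → toℕ (i ∧ j) ≤ toℕ l → toℕ i ≤ toℕ l ⊎ toℕ j ≤ toℕ l
∧≤⇒≤⊎≤ i j l i∧j≤l = Sum.map (λ eq → subst (λ t → toℕ t ≤ toℕ l) eq i∧j≤l)
                             (λ eq → subst (λ t → toℕ t ≤ toℕ l) eq i∧j≤l) (⊓-sel i j)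

module Ideals {c ℓ} (R : CommutativeRing c ℓ) where
  open import Level using (_⊔_)
  open CommutativeRing R
  open Ring R
  open import Algebra.Properties.CommutativeSemigroup *-commutativeSemigroup using (interchange)
  open import Algebra.Properties.CommutativeSemigroup +-commutativeSemigroup
    using () renaming (interchange to +-interchange)
  open import Relation.Binary.Reasoning.Setoid setoid

  ≐-refl : ∀ {q} {A : Pr q} → A ≐ A
  ≐-refl = id , id

  ⊆-Ann-Ann : ∀ {q} (A : Pr q) → A ⊆ Ann (Ann A)
  ⊆-Ann-Ann A a∈A b∈AnnA = trans (*-comm _ _) (b∈AnnA a∈A)

  Ann-isIdeal : ∀ {q} (A : Pr q) → IsIdeal (Ann A)
  Ann-isIdeal A = record
    { resp    = λ x≈y x∈ a∈A → trans (*-congʳ (sym x≈y)) (x∈ a∈A)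
    ; has0    = λ {y} _ → zeroˡ y
    ; +closed = λ x∈ y∈ a∈A →
        trans (distribʳ _ _ _) (trans (+-cong (x∈ a∈A) (y∈ a∈A)) (+-identityʳ 0#))
    ; *closed = λ r x∈ a∈A → trans (*-assoc r _ _) (trans (*-congˡ (x∈ a∈A)) (zeroʳ r))
    }

  Gen-isIdeal : ∀ {k q} {K : Set k} (f : K → Pr q) → IsIdeal (Gen f)
  Gen-isIdeal f = record { resp = gen-resp ; has0 = gen-0 ; +closed = gen-+ ; *closed = gen-* }

  Gen-least : ∀ {k q r} {K : Set k} {f : K → Pr q} {J : Pr r} →
              IsIdeal J → (∀ i → f i ⊆ J) → Gen f ⊆ J
  Gen-least {J = J} J-ideal f⊆J = least
    where
    open IsIdeal J-ideal
    least : Gen _ ⊆ J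
    least gen-0             = has0
    least (gen-in i x∈fi)   = f⊆J i x∈fi
    least (gen-+ x∈ y∈)     = +closed (least x∈) (least y∈)
    least (gen-* r x∈)      = *closed r (least x∈)
    least (gen-resp x≈y x∈) = resp x≈y (least x∈)

  Gen-map : ∀ {k k′ q q′} {K : Set k} {K′ : Set k′} {f : K → Pr q} {g : K′ → Pr q′} →
            (∀ i → ∃ λ j → f i ⊆ g j) → Gen f ⊆ Gen g
  Gen-map f⊆g = Gen-least (Gen-isIdeal _) λ i x∈fi → gen-in (proj₁ (f⊆g i)) (proj₂ (f⊆g i) x∈fi)

  GenList : ∀ {k q} {K : Set k} → (K → Pr q) → List K → Pr (c ⊔ ℓ ⊔ q)
  GenList f ks = Gen (λ (i : Fin (length ks)) → f (lookup ks i))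

  GenList-mono : ∀ {k q} {K : Set k} (f : K → Pr q) {ks ks′ : List K} →
                 ks ⊆ˡ ks′ → GenList f ks ⊆ GenList f ks′
  GenList-mono f sub = Gen-map λ i →
    index (sub (∈-lookup i)) , subst (λ t → f t _) (lookup-index (sub (∈-lookup i)))

  Gen-finite : ∀ {k q} {K : Set k} {f : K → Pr q} {z} → Gen f z → ∃ λ ks → GenList f ks z
  Gen-finite gen-0             = [] , gen-0
  Gen-finite (gen-in i x∈fi)   = i ∷ [] , gen-in Fin.zero x∈fi
  Gen-finite {f = f} (gen-+ x∈ y∈) with Gen-finite x∈ | Gen-finite y∈
  ... | ks , x∈′ | ks′ , y∈′ =
    ks ++ ks′ , gen-+ (GenList-mono f (xs⊆xs++ys ks ks′) x∈′)
                      (GenList-mono f (xs⊆ys++xs ks′ ks) y∈′)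
  Gen-finite (gen-* r x∈)      = map₂ (gen-* r) (Gen-finite x∈)
  Gen-finite (gen-resp x≈y x∈) = map₂ (gen-resp x≈y) (Gen-finite x∈)

  0ᴵ : Id
  0ᴵ = record { pred = λ z → Lift c (z ≈ 0#) ; isIdeal = record
    { resp    = λ x≈y x≈0 → lift (trans (sym x≈y) (lower x≈0))
    ; has0    = lift refl
    ; +closed = λ x≈0 y≈0 → lift (trans (+-cong (lower x≈0) (lower y≈0)) (+-identityʳ 0#))
    ; *closed = λ r x≈0 → lift (trans (*-congˡ (lower x≈0)) (zeroʳ r))
    } }

  1ᴵ : Id
  1ᴵ = record { pred = Whole ; isIdeal = record
    { resp = λ _ _ → tt ; has0 = tt ; +closed = λ _ _ → tt ; *closed = λ _ _ → tt } }

  Annᴵ : Id → Id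
  Annᴵ I = record { pred = Ann (pred I) ; isIdeal = Ann-isIdeal _ }

  _⊕ᴵ_ : Id → Id → Id
  I ⊕ᴵ J = record { pred = OplusI (pred I) (pred J) ; isIdeal = Ann-isIdeal _ }

  _⊙ᴵ_ : Id → Id → Id
  I ⊙ᴵ J = Annᴵ (Annᴵ I ⊕ᴵ Annᴵ J)

  _∩ᴵ_ : Id → Id → Id
  I ∩ᴵ J = record { pred = pred I ∩ pred J ; isIdeal = record
    { resp    = λ x≈y (x∈I , x∈J) → I.resp x≈y x∈I , J.resp x≈y x∈J
    ; has0    = I.has0 , J.has0
    ; +closed = λ (x∈I , x∈J) (y∈I , y∈J) → I.+closed x∈I y∈I , J.+closed x∈J y∈J
    ; *closed = λ r (x∈I , x∈J) → I.*closed r x∈I , J.*closed r x∈J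
    } }
    where
    module I = IsIdeal (isIdeal I)
    module J = IsIdeal (isIdeal J)

  _+ᴵ_ : Id → Id → Id
  I +ᴵ J = record { pred = λ z → ∃₂ λ u v → pred I u × pred J v × z ≈ u + v ; isIdeal = record
    { resp    = λ x≈y (u , v , u∈I , v∈J , x≈u+v) → u , v , u∈I , v∈J , trans (sym x≈y) x≈u+v
    ; has0    = 0# , 0# , I.has0 , J.has0 , sym (+-identityʳ 0#)
    ; +closed = λ (u , v , u∈I , v∈J , x≈u+v) (u′ , v′ , u′∈I , v′∈J , y≈u′+v′) →
        u + u′ , v + v′ , I.+closed u∈I u′∈I , J.+closed v∈J v′∈J ,
        trans (+-cong x≈u+v y≈u′+v′) (+-interchange u v u′ v′)
    ; *closed = λ r (u , v , u∈I , v∈J , x≈u+v) →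
        r * u , r * v , I.*closed r u∈I , J.*closed r v∈J ,
        trans (*-congˡ x≈u+v) (distribˡ r u v)
    } }
    where
    module I = IsIdeal (isIdeal I)
    module J = IsIdeal (isIdeal J)

  ⟨_⟩ : Carrier → Id
  ⟨ a ⟩ = record { pred = λ z → ∃ λ r → z ≈ r * a ; isIdeal = record
    { resp    = λ x≈y (r , x≈ra) → r , trans (sym x≈y) x≈ra
    ; has0    = 0# , sym (zeroˡ a)
    ; +closed = λ (r , x≈ra) (s , y≈sa) →
        r + s , trans (+-cong x≈ra y≈sa) (sym (distribʳ a r s))
    ; *closed = λ t (r , x≈ra) → t * r , trans (*-congˡ x≈ra) (sym (*-assoc t r a))
    } }

  a∈⟨a⟩ : ∀ a → pred ⟨ a ⟩ a
  a∈⟨a⟩ a = 1# , sym (*-identityˡ a)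

  ⟨⟩-least : ∀ {r} {J : Pr r} → IsIdeal J → ∀ {a} → J a → pred ⟨ a ⟩ ⊆ J
  ⟨⟩-least J-ideal a∈J (r , z≈ra) =
    IsIdeal.resp J-ideal (sym z≈ra) (IsIdeal.*closed J-ideal r a∈J)

  ⊆-+ᴵˡ : ∀ I J → pred I ⊆ pred (I +ᴵ J)
  ⊆-+ᴵˡ I J u∈I = _ , 0# , u∈I , IsIdeal.has0 (isIdeal J) , sym (+-identityʳ _)

  ⊆-+ᴵʳ : ∀ I J → pred J ⊆ pred (I +ᴵ J)
  ⊆-+ᴵʳ I J v∈J = 0# , _ , IsIdeal.has0 (isIdeal I) , v∈J , sym (+-identityˡ _)

  +ᴵ-least : ∀ I J {r} {K : Pr r} → IsIdeal K → pred I ⊆ K → pred J ⊆ K → pred (I +ᴵ J) ⊆ K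
  +ᴵ-least I J K-ideal I⊆K J⊆K (u , v , u∈I , v∈J , z≈u+v) =
    IsIdeal.resp K-ideal (sym z≈u+v) (IsIdeal.+closed K-ideal (I⊆K u∈I) (J⊆K v∈J))

  *-∈-Prod : ∀ {q r} {A : Pr q} {B : Pr r} {a b} → A a → B b → Prod A B (a * b)
  *-∈-Prod {a = a} {b} a∈A b∈B = gen-in ((a , b) , a∈A , b∈B) refl

  *-∈-⊙ᴵ : ∀ I J {a b} → pred I a → pred J b → pred (I ⊙ᴵ J) (a * b)
  *-∈-⊙ᴵ I J a∈I b∈J y∈ = trans (*-comm _ _) (y∈ ab∈¬¬I·¬¬J)
    where
    ab∈¬¬I·¬¬J = *-∈-Prod {A = Ann (Ann (pred I))} {Ann (Ann (pred J))}
                          (⊆-Ann-Ann (pred I) a∈I) (⊆-Ann-Ann (pred J) b∈J)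

  square⊆prime⇒⊆ : ∀ {P A} → IsPrime P → pred (A ⊙ᴵ A) ⊆ pred P → pred A ⊆ pred P
  square⊆prime⇒⊆ {A = A} P-prime A⊙A⊆P z∈A =
    [ id , id ] (IsPrime.prime P-prime _ _ (A⊙A⊆P (*-∈-⊙ᴵ A A z∈A z∈A)))

  record IdempotentGenerator (T : Id) : Set p where
    field
      idem   : Carrier
      idem∈  : pred T idem
      absorb : ∀ {z} → pred T z → z ≈ z * idem
  open IdempotentGenerator

  complemented⇒idempotentGenerated : ∀ T → pred (T +ᴵ Annᴵ T) 1# → IdempotentGenerator T
  complemented⇒idempotentGenerated T (e , f , e∈T , f∈AnnT , 1≈e+f) = record
    { idem = e ; idem∈ = e∈T ; absorb = λ {z} z∈T → begin
      z             ≈⟨ sym (*-identityʳ z) ⟩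
      z * 1#        ≈⟨ *-congˡ 1≈e+f ⟩
      z * (e + f)   ≈⟨ distribˡ z e f ⟩
      z * e + z * f ≈⟨ +-congˡ (trans (*-comm z f) (f∈AnnT z∈T)) ⟩
      z * e + 0#    ≈⟨ +-identityʳ _ ⟩
      z * e         ∎ }

  idempotentGenerated-⊆ : ∀ {T} (g : IdempotentGenerator T) {r} {J : Pr r} →
                          IsIdeal J → J (idem g) → pred T ⊆ J
  idempotentGenerated-⊆ g J-ideal e∈J {z} z∈T =
    IsIdeal.resp J-ideal (sym (absorb g z∈T)) (IsIdeal.*closed J-ideal z e∈J)

  idempotentGenerated⇒compact : ∀ {T} → IdempotentGenerator T → IsCompact T
  idempotentGenerated⇒compact g K f T⊆Gen with Gen-finite (T⊆Gen (idem∈ g))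
  ... | ks , e∈ = ks , idempotentGenerated-⊆ g (Gen-isIdeal _) e∈

  ⟨⟩-∩ : ∀ {a} b → IdempotentGenerator ⟨ a ⟩ → (pred ⟨ a ⟩ ∩ pred ⟨ b ⟩) ⊆ pred ⟨ a * b ⟩
  ⟨⟩-∩ {a} b g {z} (z∈⟨a⟩ , t , z≈tb) = t * r , (begin
    z                 ≈⟨ absorb g z∈⟨a⟩ ⟩
    z * idem g        ≈⟨ *-cong z≈tb e≈ra ⟩
    (t * b) * (r * a) ≈⟨ interchange t b r a ⟩
    (t * r) * (b * a) ≈⟨ *-congˡ (*-comm b a) ⟩
    (t * r) * (a * b) ∎)
    where
    r = proj₁ (idem∈ g)
    e≈ra = proj₂ (idem∈ g)

  rad-closure : IsClosureOperator
  rad-closure = (λ I z∈I P _ I⊆P → I⊆P z∈I)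
              , (λ I J I⊆J z∈√I P P-prime J⊆P → z∈√I P P-prime (λ x∈I → J⊆P (I⊆J x∈I)))
              , λ I → (λ z∈√√I P P-prime I⊆P → z∈√√I P P-prime (λ x∈√I → x∈√I P P-prime I⊆P))
                    , (λ z∈√I P _ √I⊆P → √I⊆P z∈√I)

module LukasiewiczIdeals {c ℓ a} (R : CommutativeRing c ℓ) (X : Set a) (n : X → ℕ)
  (n≥2 : ∀ x → 2 ≤ n x) (φ : Ring.Id R → ΠŁ X n) (iso : Ring.IsMVIso R X n φ) where

  open CommutativeRing R
  open Ring R
  open Ideals R
  open IdempotentGenerator
  open IsMVIso iso
  open Data.Nat.Properties.≤-Reasoning

  _≤Π_ : ΠŁ X n → ΠŁ X n → Set a
  u ≤Π v = ∀ x → toℕ (u x) ≤ toℕ (v x)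

  toℕ-φ-0ᴵ : ∀ x → toℕ (φ 0ᴵ x) ≡ 0
  toℕ-φ-0ᴵ = pres-0 0ᴵ (lower , lift)

  toℕ-φ-1ᴵ : ∀ x → toℕ (φ 1ᴵ x) ≡ n x ∸ 1
  toℕ-φ-1ᴵ = pres-1 1ᴵ ≐-refl

  φ-Annᴵ : ∀ I x → φ (Annᴵ I) x ≡ ¬Ł (φ I x)
  φ-Annᴵ I = pres-¬ I (Annᴵ I) ≐-refl

  φ-Annᴵ-⊕ᴵ : ∀ I J x → φ (Annᴵ I ⊕ᴵ J) x ≡ ¬Ł (φ I x) ⊕Ł φ J x
  φ-Annᴵ-⊕ᴵ I J x =
    ≡.trans (pres-⊕ (Annᴵ I) J (Annᴵ I ⊕ᴵ J) ≐-refl x) (cong (_⊕Ł φ J x) (φ-Annᴵ I x))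

  φ-⊙ᴵ : ∀ I J x → φ (I ⊙ᴵ J) x ≡ φ I x ⊙Ł φ J x
  φ-⊙ᴵ I J x = ≡.trans (φ-Annᴵ (Annᴵ I ⊕ᴵ Annᴵ J) x) (cong ¬Ł (≡.trans
    (φ-Annᴵ-⊕ᴵ I (Annᴵ J) x) (cong (¬Ł (φ I x) ⊕Ł_) (φ-Annᴵ J x))))

  Ann-Ann-⊆ : ∀ I → pred (Annᴵ (Annᴵ I)) ⊆ pred I
  Ann-Ann-⊆ I = proj₁ (injective (Annᴵ (Annᴵ I)) I λ x → ≡.trans (φ-Annᴵ (Annᴵ I) x)
    (≡.trans (cong ¬Ł (φ-Annᴵ I x)) (opposite-involutive (φ I x))))

  φ-mono : ∀ {I J} → pred I ⊆ pred J → φ I ≤Π φ J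
  φ-mono {I} {J} I⊆J x = ¬Ł⊕Ł≡top⇒≤ (φ I x) (φ J x) (begin-equality
    toℕ (¬Ł (φ I x) ⊕Ł φ J x)   ≡⟨ cong toℕ (φ-Annᴵ-⊕ᴵ I J x) ⟨
    toℕ (φ (Annᴵ I ⊕ᴵ J) x)     ≡⟨ pres-1 (Annᴵ I ⊕ᴵ J) ¬I⊕J≐1 x ⟩
    n x ∸ 1                     ∎)
    where
    ¬I·¬J⊆0 : Prod (Ann (Ann (pred I))) (Ann (pred J)) ⊆ pred 0ᴵ
    ¬I·¬J⊆0 = Gen-least (isIdeal 0ᴵ) λ ((u , v) , u∈¬¬I , v∈¬J) z≈uv →
      lift (trans z≈uv (u∈¬¬I (λ w∈I → v∈¬J (I⊆J w∈I))))
    ¬I⊕J≐1 : pred (Annᴵ I ⊕ᴵ J) ≐ Whole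
    ¬I⊕J≐1 = (λ _ → tt) , λ {w} _ y∈ → trans (*-congˡ (lower (¬I·¬J⊆0 y∈))) (zeroʳ w)

  φ-reflect : ∀ {I J} → φ I ≤Π φ J → pred I ⊆ pred J
  φ-reflect {I} {J} I≤J {z} z∈I = Ann-Ann-⊆ J λ {v} v∈¬J →
    trans (sym (*-identityˡ _))
          (1∈¬I⊕J (*-∈-Prod {A = Ann (Ann (pred I))} (⊆-Ann-Ann (pred I) z∈I) λ {y} → v∈¬J {y}))
    where
    1∈¬I⊕J : pred (Annᴵ I ⊕ᴵ J) 1#
    1∈¬I⊕J = proj₁ (injective 1ᴵ (Annᴵ I ⊕ᴵ J) λ x → toℕ-injective (begin-equality
      toℕ (φ 1ᴵ x)                ≡⟨ toℕ-φ-1ᴵ x ⟩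
      n x ∸ 1                     ≡⟨ ≤⇒¬Ł⊕Ł≡top (I≤J x) ⟨
      toℕ (¬Ł (φ I x) ⊕Ł φ J x)   ≡⟨ cong toℕ (φ-Annᴵ-⊕ᴵ I J x) ⟨
      toℕ (φ (Annᴵ I ⊕ᴵ J) x)     ∎)) tt

  φ⁻¹ : ΠŁ X n → Id
  φ⁻¹ u = proj₁ (surjective u)

  toℕ-φ-φ⁻¹ : ∀ u x → toℕ (φ (φ⁻¹ u) x) ≡ toℕ (u x)
  toℕ-φ-φ⁻¹ u x = cong toℕ (proj₂ (surjective u) x)

  φ⁻¹-⊆ : ∀ {u I} → u ≤Π φ I → pred (φ⁻¹ u) ⊆ pred I
  φ⁻¹-⊆ {u} u≤I = φ-reflect λ x → ≤-trans (≤-reflexive (toℕ-φ-φ⁻¹ u x)) (u≤I x)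

  ⊆-φ⁻¹ : ∀ {u I} → φ I ≤Π u → pred I ⊆ pred (φ⁻¹ u)
  ⊆-φ⁻¹ {u} I≤u = φ-reflect λ x → ≤-trans (I≤u x) (≤-reflexive (≡.sym (toℕ-φ-φ⁻¹ u x)))

  φ⁻¹-⊆⇒≤ : ∀ {u I} → pred (φ⁻¹ u) ⊆ pred I → u ≤Π φ I
  φ⁻¹-⊆⇒≤ {u} sub x = ≤-trans (≤-reflexive (≡.sym (toℕ-φ-φ⁻¹ u x))) (φ-mono sub x)

  ⊆-φ⁻¹⇒≤ : ∀ {u I} → pred I ⊆ pred (φ⁻¹ u) → φ I ≤Π u
  ⊆-φ⁻¹⇒≤ {u} sub x = ≤-trans (φ-mono sub x) (≤-reflexive (toℕ-φ-φ⁻¹ u x))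

  φ-∩ᴵ : ∀ I J x → φ (I ∩ᴵ J) x ≡ φ I x ∧ φ J x
  φ-∩ᴵ I J x = ≤ᶠ-antisym (⊓-glb (φ-mono proj₁ x) (φ-mono proj₂ x)) (φ⁻¹-⊆⇒≤ K⊆I∩J x)
    where
    K⊆I∩J : pred (φ⁻¹ (λ y → φ I y ∧ φ J y)) ⊆ pred (I ∩ᴵ J)
    K⊆I∩J z∈K = φ⁻¹-⊆ (λ y → x⊓y≤x (φ I y) (φ J y)) z∈K
              , φ⁻¹-⊆ (λ y → x⊓y≤y (φ I y) (φ J y)) z∈K

  φ-+ᴵ : ∀ I J x → φ (I +ᴵ J) x ≡ φ I x ∨ φ J x
  φ-+ᴵ I J x =
    ≤ᶠ-antisym (⊆-φ⁻¹⇒≤ I+J⊆K x) (⊔-lub (φ-mono (⊆-+ᴵˡ I J) x) (φ-mono (⊆-+ᴵʳ I J) x))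
    where
    K = φ⁻¹ (λ y → φ I y ∨ φ J y)
    I+J⊆K : pred (I +ᴵ J) ⊆ pred K
    I+J⊆K = +ᴵ-least I J (isIdeal K) (⊆-φ⁻¹ {I = I} (λ y → x≤x⊔y (φ I y) (φ J y)))
                                     (⊆-φ⁻¹ {I = J} (λ y → x≤y⊔x (φ I y) (φ J y)))

  ∩⊆⇒≤⊎≤ : ∀ {I J Q} → (pred I ∩ pred J) ⊆ pred Q →
           ∀ x → toℕ (φ I x) ≤ toℕ (φ Q x) ⊎ toℕ (φ J x) ≤ toℕ (φ Q x)
  ∩⊆⇒≤⊎≤ {I} {J} {Q} I∩J⊆Q x = ∧≤⇒≤⊎≤ (φ I x) (φ J x) (φ Q x)
    (subst (λ t → toℕ t ≤ toℕ (φ Q x)) (φ-∩ᴵ I J x) (φ-mono {I ∩ᴵ J} I∩J⊆Q x))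

  IsBoolean : Id → Set a
  IsBoolean B = ∀ x → toℕ (φ B x) ≡ 0 ⊎ toℕ (φ B x) ≡ n x ∸ 1

  boolean⇒idempotentGenerated : ∀ {B} → IsBoolean B → IdempotentGenerator B
  boolean⇒idempotentGenerated {B} B-boolean =
    complemented⇒idempotentGenerated B (φ-reflect 1≤B∨¬B tt)
    where
    1≤B∨¬B : φ 1ᴵ ≤Π φ (B +ᴵ Annᴵ B)
    1≤B∨¬B x rewrite toℕ-φ-1ᴵ x | φ-+ᴵ B (Annᴵ B) x | φ-Annᴵ B x = [ B≡0 , B≡1 ] (B-boolean x)
      where
      B≡0 : toℕ (φ B x) ≡ 0 → n x ∸ 1 ≤ toℕ (φ B x ∨ ¬Ł (φ B x))
      B≡0 B≡0 = begin
        n x ∸ 1                    ≡⟨ cong (n x ∸ 1 ∸_) B≡0 ⟨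
        n x ∸ 1 ∸ toℕ (φ B x)      ≡⟨ toℕ-¬Ł (φ B x) ⟨
        toℕ (¬Ł (φ B x))           ≤⟨ x≤y⊔x (φ B x) (¬Ł (φ B x)) ⟩
        toℕ (φ B x ∨ ¬Ł (φ B x))   ∎
      B≡1 : toℕ (φ B x) ≡ n x ∸ 1 → n x ∸ 1 ≤ toℕ (φ B x ∨ ¬Ł (φ B x))
      B≡1 B≡1 = ≤-trans (≤-reflexive (≡.sym B≡1)) (x≤x⊔y (φ B x) (¬Ł (φ B x)))

  module _ {D : X → Set} (D? : ∀ x → Dec (D x)) where

    χ : Id
    χ = φ⁻¹ (λ x → indicator (<⇒≤ (n≥2 x)) (D? x))

    toℕ-φ-χ-yes : ∀ {x} → D x → toℕ (φ χ x) ≡ n x ∸ 1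
    toℕ-φ-χ-yes {x} d = ≡.trans (toℕ-φ-φ⁻¹ _ x) (toℕ-indicator-yes _ (D? x) d)

    toℕ-φ-χ-no : ∀ {x} → ¬ D x → toℕ (φ χ x) ≡ 0
    toℕ-φ-χ-no {x} ¬d = ≡.trans (toℕ-φ-φ⁻¹ _ x) (toℕ-indicator-no _ (D? x) ¬d)

    χ-idempotentGenerated : IdempotentGenerator χ
    χ-idempotentGenerated = boolean⇒idempotentGenerated λ x → boolean (D? x)
      where
      boolean : ∀ {x} → Dec (D x) → toℕ (φ χ x) ≡ 0 ⊎ toℕ (φ χ x) ≡ n x ∸ 1
      boolean (yes d) = inj₂ (toℕ-φ-χ-yes d)
      boolean (no ¬d) = inj₁ (toℕ-φ-χ-no ¬d)

  prime⇒≥top∸1 : ∀ {P} → IsPrime P → ∀ x → n x ∸ 2 ≤ toℕ (φ P x)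
  prime⇒≥top∸1 {P} P-prime x = proj₂ (proj₂ (∃-bump (φ P x))) (φ⁻¹-⊆⇒≤ A⊆P x)
    where
    b : ΠŁ X n
    b y = proj₁ (∃-bump (φ P y))
    A = φ⁻¹ b
    A⊙A⊆P : pred (A ⊙ᴵ A) ⊆ pred P
    A⊙A⊆P = φ-reflect λ y → begin
      toℕ (φ (A ⊙ᴵ A) y)          ≡⟨ cong toℕ (φ-⊙ᴵ A A y) ⟩
      toℕ (φ A y ⊙Ł φ A y)        ≡⟨ cong (λ t → toℕ (t ⊙Ł t)) (proj₂ (surjective b) y) ⟩
      toℕ (b y ⊙Ł b y)            ≤⟨ proj₁ (proj₂ (∃-bump (φ P y))) ⟩
      toℕ (φ P y)                 ∎
    A⊆P : pred A ⊆ pred P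
    A⊆P = square⊆prime⇒⊆ {P} {A} P-prime A⊙A⊆P

  module _ (P I : Id) where

    excess? : ∀ x → Dec (toℕ (φ P x) < toℕ (φ I x))
    excess? x = toℕ (φ P x) <? toℕ (φ I x)

    excess : Id
    excess = χ excess?

    excess⊆⇒⊆ : pred excess ⊆ pred P → pred I ⊆ pred P
    excess⊆⇒⊆ excess⊆P = φ-reflect λ x → I≤P x (excess? x)
      where
      I≤P : ∀ x → Dec (toℕ (φ P x) < toℕ (φ I x)) → toℕ (φ I x) ≤ toℕ (φ P x)
      I≤P x (no P≮I)  = ≮⇒≥ P≮I
      I≤P x (yes P<I) = contradiction (begin
        toℕ (φ I x)        ≤⟨ toℕ≤top (φ I x) ⟩
        n x ∸ 1            ≡⟨ toℕ-φ-χ-yes excess? P<I ⟨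
        toℕ (φ excess x)   ≤⟨ φ-mono excess⊆P x ⟩
        toℕ (φ P x)        ∎) (<⇒≱ P<I)

  excess-∩ : ∀ {P I J} → (pred I ∩ pred J) ⊆ pred P →
             (pred (excess P I) ∩ pred (excess P J)) ⊆ pred 0ᴵ
  excess-∩ {P} {I} {J} I∩J⊆P = φ-reflect {EI ∩ᴵ EJ} {0ᴵ} λ x → begin
    toℕ (φ (EI ∩ᴵ EJ) x)        ≡⟨ cong toℕ (φ-∩ᴵ EI EJ x) ⟩
    toℕ (φ EI x ∧ φ EJ x)       ≤⟨ vanishes x (excess? P I x) (excess? P J x) ⟩
    0                           ≡⟨ toℕ-φ-0ᴵ x ⟨
    toℕ (φ 0ᴵ x)                ∎
    where
    EI = excess P I
    EJ = excess P J
    vanishes : ∀ x → Dec (toℕ (φ P x) < toℕ (φ I x)) → Dec (toℕ (φ P x) < toℕ (φ J x)) →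
               toℕ (φ EI x ∧ φ EJ x) ≤ 0
    vanishes x (no P≮I) _ =
      ≤-trans (x⊓y≤x (φ EI x) (φ EJ x)) (≤-reflexive (toℕ-φ-χ-no (excess? P I) P≮I))
    vanishes x (yes _) (no P≮J) =
      ≤-trans (x⊓y≤y (φ EI x) (φ EJ x)) (≤-reflexive (toℕ-φ-χ-no (excess? P J) P≮J))
    vanishes x (yes P<I) (yes P<J) =
      contradiction (∩⊆⇒≤⊎≤ {I} {J} {P} I∩J⊆P x) [ <⇒≱ P<I , <⇒≱ P<J ]

  -- Constructively we cannot pick a ∈ I ∖ P and b ∈ J ∖ P; the idempotents generating the
  -- excesses of I and J over P take their place.
  prime⇒∩-prime : ∀ {P I J} → IsPrime P → (pred I ∩ pred J) ⊆ pred P →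
                  pred I ⊆ pred P ⊎ pred J ⊆ pred P
  prime⇒∩-prime {P} {I} {J} P-prime I∩J⊆P =
    Sum.map (idem∈P⇒⊆ I gI) (idem∈P⇒⊆ J gJ) (IsPrime.prime P-prime (idem gI) (idem gJ) eIeJ∈P)
    where
    module P = IsIdeal (isIdeal P)
    gI = χ-idempotentGenerated (excess? P I)
    gJ = χ-idempotentGenerated (excess? P J)
    eIeJ∈P : pred P (idem gI * idem gJ)
    eIeJ∈P = P.resp (sym (lower (excess-∩ {P} {I} {J} I∩J⊆P (eIeJ∈EI , eIeJ∈EJ)))) P.has0
      where
      module EI = IsIdeal (isIdeal (excess P I))
      module EJ = IsIdeal (isIdeal (excess P J))
      eIeJ∈EI = EI.resp (*-comm _ _) (EI.*closed (idem gJ) (idem∈ gI))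
      eIeJ∈EJ = EJ.*closed (idem gI) (idem∈ gJ)
    idem∈P⇒⊆ : ∀ K (g : IdempotentGenerator (excess P K)) → pred P (idem g) → pred K ⊆ pred P
    idem∈P⇒⊆ K g e∈P = excess⊆⇒⊆ P K (idempotentGenerated-⊆ g (isIdeal P) e∈P)

  rad-∩ : PreservesMeets
  rad-∩ I J = (λ z∈√I∩J → (λ P P-prime I⊆P → z∈√I∩J P P-prime (λ x∈I∩J → I⊆P (proj₁ x∈I∩J)))
                        , (λ P P-prime J⊆P → z∈√I∩J P P-prime (λ x∈I∩J → J⊆P (proj₂ x∈I∩J))))
            , λ (z∈√I , z∈√J) P P-prime I∩J⊆P →
                [ z∈√I P P-prime , z∈√J P P-prime ] (prime⇒∩-prime {P} {I} {J} P-prime I∩J⊆P)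

  module _ (I : Id) where

    isTop? : ∀ x → Dec (toℕ (φ I x) ≡ n x ∸ 1)
    isTop? x = toℕ (φ I x) ≟ n x ∸ 1

    booleanCore : Id
    booleanCore = χ isTop?

    booleanCore-⊆ : pred booleanCore ⊆ pred I
    booleanCore-⊆ = φ-reflect λ x → core≤I x (isTop? x)
      where
      core≤I : ∀ x → Dec (toℕ (φ I x) ≡ n x ∸ 1) → toℕ (φ booleanCore x) ≤ toℕ (φ I x)
      core≤I x (yes top) = ≤-reflexive (≡.trans (toℕ-φ-χ-yes isTop? top) (≡.sym top))
      core≤I x (no ¬top) = ≤-trans (≤-reflexive (toℕ-φ-χ-no isTop? ¬top)) z≤n

    booleanCore⊆prime⇒⊆ : ∀ {P} → IsPrime P → pred booleanCore ⊆ pred P → pred I ⊆ pred P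
    booleanCore⊆prime⇒⊆ {P} P-prime core⊆P = φ-reflect λ x → I≤P x (isTop? x)
      where
      I≤P : ∀ x → Dec (toℕ (φ I x) ≡ n x ∸ 1) → toℕ (φ I x) ≤ toℕ (φ P x)
      I≤P x (yes top) = begin
        toℕ (φ I x)             ≡⟨ top ⟩
        n x ∸ 1                 ≡⟨ toℕ-φ-χ-yes isTop? top ⟨
        toℕ (φ booleanCore x)   ≤⟨ φ-mono core⊆P x ⟩
        toℕ (φ P x)             ∎
      I≤P x (no ¬top) = ≤-trans (≢top⇒≤top∸1 (φ I x) ¬top) (prime⇒≥top∸1 P-prime x)

  rad-inductive : IsInductive
  rad-inductive I =
      (λ z∈√I → gen-in (booleanCore I , core-compact , λ {x} → booleanCore-⊆ I {x})
                       λ P P-prime core⊆P → z∈√I P P-prime (booleanCore⊆prime⇒⊆ I P-prime core⊆P))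
    , λ z∈⋁ P P-prime I⊆P →
        Gen-least (isIdeal P) (λ (A , _ , A⊆I) z∈√A → z∈√A P P-prime (λ w∈A → I⊆P (A⊆I w∈A))) z∈⋁
    where
    core-compact = idempotentGenerated⇒compact (χ-idempotentGenerated (isTop? I))

  dense⇒n≡2 : IsDense → ∀ x → n x ≡ 2
  dense⇒n≡2 (√0⊆0 , _) x = ≤-antisym (m∸n≡0⇒m≤n (n≤0⇒n≡0 (begin
      n x ∸ 2                     ≡⟨ toℕ-penultimate (n≥2 x) ⟨
      toℕ (penultimate (n≥2 x))   ≡⟨ toℕ-φ-φ⁻¹ u x ⟨
      toℕ (φ M x)                 ≤⟨ φ-mono M⊆0 x ⟩
      toℕ (φ 0ᴵ x)                ≡⟨ toℕ-φ-0ᴵ x ⟩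
      0                           ∎))) (n≥2 x)
    where
    u : ΠŁ X n
    u y = penultimate (n≥2 y)
    M = φ⁻¹ u
    M⊆0 : pred M ⊆ pred 0ᴵ
    M⊆0 z∈M = lift (√0⊆0 λ P P-prime _ → φ⁻¹-⊆ (u≤P P-prime) z∈M)
      where
      u≤P : ∀ {P} → IsPrime P → u ≤Π φ P
      u≤P P-prime y = ≤-trans (≤-reflexive (toℕ-penultimate (n≥2 y))) (prime⇒≥top∸1 P-prime y)

  kernelAt : X → Id
  kernelAt x₀ = record { pred = λ z → Lift p (toℕ (φ ⟨ z ⟩ x₀) ≤ toℕ (φ 0ᴵ x₀)) ; isIdeal = record
    { resp    = λ {z} z≈w (lift z≤0) → lift (≤-trans (⟨⟩-mono (⟨z⟩.resp z≈w (a∈⟨a⟩ z))) z≤0)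
    ; has0    = lift (φ-mono (⟨⟩-least (isIdeal 0ᴵ) (lift refl)) x₀)
    ; +closed = λ {z} {w} (lift z≤0) (lift w≤0) → lift (begin
        toℕ (φ ⟨ z + w ⟩ x₀)          ≤⟨ φ-mono (⟨⟩-least (isIdeal (⟨ z ⟩ +ᴵ ⟨ w ⟩)) z+w∈) x₀ ⟩
        toℕ (φ (⟨ z ⟩ +ᴵ ⟨ w ⟩) x₀)     ≡⟨ cong toℕ (φ-+ᴵ ⟨ z ⟩ ⟨ w ⟩ x₀) ⟩
        toℕ (φ ⟨ z ⟩ x₀ ∨ φ ⟨ w ⟩ x₀)   ≤⟨ ⊔-lub z≤0 w≤0 ⟩
        toℕ (φ 0ᴵ x₀)                   ∎)
    ; *closed = λ r {z} (lift z≤0) → lift (≤-trans (⟨⟩-mono (⟨z⟩.*closed r (a∈⟨a⟩ z))) z≤0)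
    } }
    where
    module ⟨z⟩ {z} = IsIdeal (isIdeal ⟨ z ⟩)
    ⟨⟩-mono : ∀ {z w} → pred ⟨ z ⟩ w → toℕ (φ ⟨ w ⟩ x₀) ≤ toℕ (φ ⟨ z ⟩ x₀)
    ⟨⟩-mono {z} w∈⟨z⟩ = φ-mono (⟨⟩-least (isIdeal ⟨ z ⟩) w∈⟨z⟩) x₀
    z+w∈ : ∀ {z w} → pred (⟨ z ⟩ +ᴵ ⟨ w ⟩) (z + w)
    z+w∈ {z} {w} = z , w , a∈⟨a⟩ z , a∈⟨a⟩ w , refl

  n≡2⇒boolean : (∀ x → n x ≡ 2) → ∀ I → IsBoolean I
  n≡2⇒boolean n≡2 I x with toℕ (φ I x) | toℕ≤top (φ I x)
  ... | 0     | _   = inj₁ ≡.refl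
  ... | suc k | ≤n∸1 = inj₂ (≤-antisym ≤n∸1 (subst (λ m → m ∸ 1 ≤ suc k) (≡.sym (n≡2 x)) (s≤s z≤n)))

  kernelAt-prime : (∀ x → n x ≡ 2) → ∀ x₀ → IsPrime (kernelAt x₀)
  kernelAt-prime n≡2 x₀ = record { proper = proper ; prime = prime }
    where
    proper : ¬ pred (kernelAt x₀) 1#
    proper (lift ⟨1⟩≤0) = contradiction (begin
      1                   ≤⟨ ∸-monoˡ-≤ 1 (n≥2 x₀) ⟩
      n x₀ ∸ 1            ≡⟨ toℕ-φ-1ᴵ x₀ ⟨
      toℕ (φ 1ᴵ x₀)       ≤⟨ φ-mono (λ {z} _ → z , sym (*-identityʳ z)) x₀ ⟩
      toℕ (φ ⟨ 1# ⟩ x₀)   ≤⟨ ⟨1⟩≤0 ⟩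
      toℕ (φ 0ᴵ x₀)       ≡⟨ toℕ-φ-0ᴵ x₀ ⟩
      0                   ∎) λ ()
    prime : ∀ a b → pred (kernelAt x₀) (a * b) → pred (kernelAt x₀) a ⊎ pred (kernelAt x₀) b
    prime a b (lift ab≤0) =
      Sum.map (λ a≤ab → lift (≤-trans a≤ab ab≤0)) (λ b≤ab → lift (≤-trans b≤ab ab≤0))
              (∩⊆⇒≤⊎≤ {⟨ a ⟩} {⟨ b ⟩} {⟨ a * b ⟩} (⟨⟩-∩ b ⟨a⟩-idempotentGenerated) x₀)
      where
      ⟨a⟩-idempotentGenerated = boolean⇒idempotentGenerated (n≡2⇒boolean n≡2 ⟨ a ⟩)

  n≡2⇒dense : (∀ x → n x ≡ 2) → IsDense
  n≡2⇒dense n≡2 = (λ {z} z∈√0 → lower (φ-reflect {⟨ z ⟩} {0ᴵ} (⟨z⟩≤0 z∈√0) (a∈⟨a⟩ z)))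
                , λ z≈0 P _ 0⊆P → 0⊆P z≈0
    where
    0⊆kernelAt : ∀ x₀ → Zero ⊆ pred (kernelAt x₀)
    0⊆kernelAt x₀ z≈0 = K.resp (sym z≈0) K.has0
      where module K = IsIdeal (isIdeal (kernelAt x₀))
    ⟨z⟩≤0 : ∀ {z} → rad Zero z → φ ⟨ z ⟩ ≤Π φ 0ᴵ
    ⟨z⟩≤0 z∈√0 x₀ = lower (z∈√0 (kernelAt x₀) (kernelAt-prime n≡2 x₀) (0⊆kernelAt x₀))

proposition3p6 : ∀ {c ℓ a : Level} (R : CommutativeRing c ℓ) (X : Set a) (n : X → ℕ) →
    X → (∀ x → 2 ≤ n x) → (φ : Ring.Id R → ΠŁ X n) → Ring.IsMVIso R X n φ →
    Ring.IsClosureOperator R × Ring.IsNucleus R × Ring.IsInductive R ×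
    (Ring.IsDense R ⇔ (∀ x → n x ≡ 2))
proposition3p6 R X n _ n≥2 φ iso =
  rad-closure , (rad-closure , rad-∩) , rad-inductive , mk⇔ dense⇒n≡2 n≡2⇒dense
  where
  open Ideals R
  open LukasiewiczIdeals R X n n≥2 φ iso
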